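{- If $\Pi$ is a deduction in $\mathbf{I}$ in normal form, then every major premise of an application of an elimination rule in $\Pi$ is a (discharged or undischarged) assumption of $\Pi$.
   Context: Formulas of intuitionistic propositional logic are built from atomic formulas using the connectives $\bot$ (0-ary), $\land$, $\lor$, $\supset$; $\bot$ is not atomic. The natural deduction system $\mathbf{I}$ has tree-shaped deductions with assumptions at the leaves, grouped into assumption classes (occurrences of the same formula; a rule discharging a class discharges all its members). Rules: - $\land I$: from deductions of $A$, of $B$, and of $C$ from $[A\land B]$, conclude $C$. - $\supset I$: from a deduction of $B$ from $[A]$ and a deduction of $C$ from $[A\supset B]$, conclude $C$. - $\lor I$: from a deduction of $A$ (or of $B$) and a deduction of $C$ from $[A\lor B]$, conclude $C$. - $\land E$: from $A\land B$ and a deduction of $C$ from $[A],[B]$, conclude $C$. - $\supset E$: from $A\supset B$, $A$, and a deduction of $C$ from $[B]$, conclude $C$. - $\lor E$: from $A\lor B$, a deduction of $C$ from $[A]$ and one of $C$ from $[B]$, conclude $C$. - $\bot E$: from $\bot$ conclude $C$. A single assumption occurrence is a deduction. Standing conventions: no vacuous discharge above arbitrary premises; $\bot E$ has atomic conclusions. In elimination rules, $A\land B,A\supset B,A\lor B,\bot$ are the major premises and the $C$'s are arbitrary premises; in introduction rules the $C$ is the arbitrary premise and the discharged $A\land B, A\supset B, A\lor B$ are major assumptions discharged. A maximal formula with main operator $\ast$ is an occurrence of $A\ast B$ that is both the major premise of $\ast E$ and a major assumption discharged by $\ast I$. A segment is a sequence $C_1,\dots,C_n$ ($n>1$) of occurrences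 of the same formula, each $C_i$ ($i<n$) an arbitrary premise of a rule with conclusion $C_{i+1}$, and $C_n$ not an arbitrary premise. A maximal segment is a segment whose last formula is the major premise of an elimination rule. A deduction is in normal form if it contains no maximal formula and no maximal segment. -}

module Defs where

open import Data.Nat using (ℕ; suc; _<_)
open import Data.List using (List; []; _∷_)
open import Data.Product using (Σ; _×_)
open import Relation.Binary.PropositionalEquality using (_≡_)
open import Relation.Nullary using (¬_)

infixr 30 _∧_
infixr 20 _∨_
infixr 10 _⊃_

data Form : Set where
  atom : ℕ → Form
  ⊥f   : Form
  _∧_  : Form → Form → Form
  _∨_  : Form → Form → Form
  _⊃_  : Form → Form → Form

data Atomic : Form → Set where
  atom : (n : ℕ) → Atomic (atom n)

-- Contexts of assumption classes (de Bruijn): each entry is one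
-- assumption class; a variable points to the class of a leaf.

Ctx : Set
Ctx = List Form

infix 4 _∋_
data _∋_ : Ctx → Form → Set where
  here  : ∀ {Γ A} → (A ∷ Γ) ∋ A
  there : ∀ {Γ A B} → Γ ∋ A → (B ∷ Γ) ∋ A

-- Γ ≼ Δ : Δ is Γ extended by some discharged (bound) classes
infix 4 _≼_
data _≼_ : Ctx → Ctx → Set where
  stop : ∀ {Γ} → Γ ≼ Γ
  skip : ∀ {Γ Δ F} → Γ ≼ Δ → Γ ≼ (F ∷ Δ)

≼-trans : ∀ {Γ Δ Θ} → Γ ≼ Δ → Δ ≼ Θ → Γ ≼ Θ
≼-trans w stop     = w
≼-trans w (skip v) = skip (≼-trans w v)

lift : ∀ {Γ Δ F} → Γ ≼ Δ → Γ ∋ F → Δ ∋ F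
lift stop     x = x
lift (skip w) x = there (lift w x)

-- Deductions of system I.  Ded Γ C : deductions of C whose
-- undischarged assumption classes are among Γ.  A discharged class is
-- the newly bound context entry of the relevant premise.

data Ded (Γ : Ctx) : Form → Set where
  hyp  : ∀ {A} → Γ ∋ A → Ded Γ A
  ∧I   : ∀ {A B C} → Ded Γ A → Ded Γ B → Ded (A ∧ B ∷ Γ) C → Ded Γ C
  ⊃I   : ∀ {A B C} → Ded (A ∷ Γ) B → Ded (A ⊃ B ∷ Γ) C → Ded Γ C
  ∨I₁  : ∀ {A B C} → Ded Γ A → Ded (A ∨ B ∷ Γ) C → Ded Γ C
  ∨I₂  : ∀ {A B C} → Ded Γ B → Ded (A ∨ B ∷ Γ) C → Ded Γ C
  ∧E   : ∀ {A B C} → Ded Γ (A ∧ B) → Ded (B ∷ A ∷ Γ) C → Ded Γ C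
  ⊃E   : ∀ {A B C} → Ded Γ (A ⊃ B) → Ded Γ A → Ded (B ∷ Γ) C → Ded Γ C
  ∨E   : ∀ {A B C} → Ded Γ (A ∨ B) → Ded (A ∷ Γ) C → Ded (B ∷ Γ) C → Ded Γ C
  ⊥E   : ∀ {C} → Ded Γ ⊥f → Atomic C → Ded Γ C

data Child {Γ C} : Ded Γ C → ∀ {Δ A} → Ded Δ A → Γ ≼ Δ → Set where
  ∧I-1 : ∀ {A B} {a : Ded Γ A} {b : Ded Γ B} {d} → Child (∧I a b d) a stop
  ∧I-2 : ∀ {A B} {a : Ded Γ A} {b : Ded Γ B} {d} → Child (∧I a b d) b stop
  ∧I-3 : ∀ {A B} {a : Ded Γ A} {b : Ded Γ B} {d} → Child (∧I a b d) d (skip stop)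
  ⊃I-1 : ∀ {A B} {b : Ded (A ∷ Γ) B} {d} → Child (⊃I b d) b (skip stop)
  ⊃I-2 : ∀ {A B} {b : Ded (A ∷ Γ) B} {d} → Child (⊃I b d) d (skip stop)
  ∨I₁-1 : ∀ {A B} {a : Ded Γ A} {d : Ded (A ∨ B ∷ Γ) C} → Child (∨I₁ a d) a stop
  ∨I₁-2 : ∀ {A B} {a : Ded Γ A} {d : Ded (A ∨ B ∷ Γ) C} → Child (∨I₁ a d) d (skip stop)
  ∨I₂-1 : ∀ {A B} {b : Ded Γ B} {d : Ded (A ∨ B ∷ Γ) C} → Child (∨I₂ b d) b stop
  ∨I₂-2 : ∀ {A B} {b : Ded Γ B} {d : Ded (A ∨ B ∷ Γ) C} → Child (∨I₂ b d) d (skip stop)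
  ∧E-1 : ∀ {A B} {m : Ded Γ (A ∧ B)} {d} → Child (∧E m d) m stop
  ∧E-2 : ∀ {A B} {m : Ded Γ (A ∧ B)} {d} → Child (∧E m d) d (skip (skip stop))
  ⊃E-1 : ∀ {A B} {m : Ded Γ (A ⊃ B)} {a} {d} → Child (⊃E m a d) m stop
  ⊃E-2 : ∀ {A B} {m : Ded Γ (A ⊃ B)} {a} {d} → Child (⊃E m a d) a stop
  ⊃E-3 : ∀ {A B} {m : Ded Γ (A ⊃ B)} {a} {d} → Child (⊃E m a d) d (skip stop)
  ∨E-1 : ∀ {A B} {m : Ded Γ (A ∨ B)} {d₁ d₂} → Child (∨E m d₁ d₂) m stop
  ∨E-2 : ∀ {A B} {m : Ded Γ (A ∨ B)} {d₁ d₂} → Child (∨E m d₁ d₂) d₁ (skip stop)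
  ∨E-3 : ∀ {A B} {m : Ded Γ (A ∨ B)} {d₁ d₂} → Child (∨E m d₁ d₂) d₂ (skip stop)
  ⊥E-1 : ∀ {m : Ded Γ ⊥f} {at : Atomic C} → Child (⊥E m at) m stop

-- Desc d e w : e is (an occurrence of) a subdeduction of d;
-- w records the classes bound on the path from the root of d to e.
data Desc {Γ C} (d : Ded Γ C) : ∀ {Δ A} → Ded Δ A → Γ ≼ Δ → Set where
  here : Desc d d stop
  step : ∀ {Δ A Θ B} {e : Ded Δ A} {f : Ded Θ B} {w : Γ ≼ Δ} {v : Δ ≼ Θ}
       → Desc d e w → Child e f v → Desc d f (≼-trans w v)

data IsHyp {Γ A} : Ded Γ A → Set where
  hyp : (x : Γ ∋ A) → IsHyp (hyp x)

data MajorOf {Γ C} : Ded Γ C → ∀ {A} → Ded Γ A → Set where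
  ∧E : ∀ {A B} {m : Ded Γ (A ∧ B)} {d} → MajorOf (∧E m d) m
  ⊃E : ∀ {A B} {m : Ded Γ (A ⊃ B)} {a} {d} → MajorOf (⊃E m a d) m
  ∨E : ∀ {A B} {m : Ded Γ (A ∨ B)} {d₁ d₂} → MajorOf (∨E m d₁ d₂) m
  ⊥E : ∀ {m : Ded Γ ⊥f} {at : Atomic C} → MajorOf (⊥E m at) m

data ArbOf {Γ C} : Ded Γ C → ∀ {Δ} → Ded Δ C → Γ ≼ Δ → Set where
  ∧I  : ∀ {A B} {a : Ded Γ A} {b : Ded Γ B} {d} → ArbOf (∧I a b d) d (skip stop)
  ⊃I  : ∀ {A B} {b : Ded (A ∷ Γ) B} {d} → ArbOf (⊃I b d) d (skip stop)
  ∨I₁ : ∀ {A B} {a : Ded Γ A} {d : Ded (A ∨ B ∷ Γ) C} → ArbOf (∨I₁ a d) d (skip stop)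
  ∨I₂ : ∀ {A B} {b : Ded Γ B} {d : Ded (A ∨ B ∷ Γ) C} → ArbOf (∨I₂ b d) d (skip stop)
  ∧E  : ∀ {A B} {m : Ded Γ (A ∧ B)} {d} → ArbOf (∧E m d) d (skip (skip stop))
  ⊃E  : ∀ {A B} {m : Ded Γ (A ⊃ B)} {a} {d} → ArbOf (⊃E m a d) d (skip stop)
  ∨E₁ : ∀ {A B} {m : Ded Γ (A ∨ B)} {d₁ d₂} → ArbOf (∨E m d₁ d₂) d₁ (skip stop)
  ∨E₂ : ∀ {A B} {m : Ded Γ (A ∨ B)} {d₁ d₂} → ArbOf (∨E m d₁ d₂) d₂ (skip stop)

data DischArb {Γ C} : Ded Γ C → ∀ {Δ F} → Ded Δ C → Δ ∋ F → Set where
  ∧I  : ∀ {A B} {a : Ded Γ A} {b : Ded Γ B} {d} → DischArb (∧I a b d) d here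
  ⊃I  : ∀ {A B} {b : Ded (A ∷ Γ) B} {d} → DischArb (⊃I b d) d here
  ∨I₁ : ∀ {A B} {a : Ded Γ A} {d : Ded (A ∨ B ∷ Γ) C} → DischArb (∨I₁ a d) d here
  ∨I₂ : ∀ {A B} {b : Ded Γ B} {d : Ded (A ∨ B ∷ Γ) C} → DischArb (∨I₂ b d) d here
  ∧E₁ : ∀ {A B} {m : Ded Γ (A ∧ B)} {d} → DischArb (∧E m d) d (there here)
  ∧E₂ : ∀ {A B} {m : Ded Γ (A ∧ B)} {d} → DischArb (∧E m d) d here
  ⊃E  : ∀ {A B} {m : Ded Γ (A ⊃ B)} {a} {d} → DischArb (⊃E m a d) d here
  ∨E₁ : ∀ {A B} {m : Ded Γ (A ∨ B)} {d₁ d₂} → DischArb (∨E m d₁ d₂) d₁ here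
  ∨E₂ : ∀ {A B} {m : Ded Γ (A ∨ B)} {d₁ d₂} → DischArb (∨E m d₁ d₂) d₂ here

record Uses {Γ C F} (d : Ded Γ C) (x : Γ ∋ F) : Set where
  constructor uses
  field
    {Δ} : Ctx
    {w} : Γ ≼ Δ
    occ : Desc d (hyp (lift w x)) w

NoVacuous : ∀ {Γ C} → Ded Γ C → Set
NoVacuous {Γ} Π = ∀ {Δ Θ A F} {e : Ded Δ A} {w : Γ ≼ Δ} {d : Ded Θ A} {x : Θ ∋ F}
                  → Desc Π e w → DischArb e d x → Uses d x

-- IntroMaj e d : the last rule of e is an introduction ∗I whose
-- arbitrary premise is d, discharging the major assumption class
-- (A ∗ B), which is the entry `here` of d's context
data IntroMaj {Γ C} : Ded Γ C → ∀ {F} → Ded (F ∷ Γ) C → Set where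
  ∧I  : ∀ {A B} {a : Ded Γ A} {b : Ded Γ B} {d} → IntroMaj (∧I a b d) d
  ⊃I  : ∀ {A B} {b : Ded (A ∷ Γ) B} {d} → IntroMaj (⊃I b d) d
  ∨I₁ : ∀ {A B} {a : Ded Γ A} {d : Ded (A ∨ B ∷ Γ) C} → IntroMaj (∨I₁ a d) d
  ∨I₂ : ∀ {A B} {b : Ded Γ B} {d : Ded (A ∨ B ∷ Γ) C} → IntroMaj (∨I₂ b d) d

-- an occurrence of A ∗ B which is a major assumption discharged by ∗I
-- and the major premise of an elimination rule (necessarily ∗E)
record MaximalFormula {Γ C} (Π : Ded Γ C) : Set where
  field
    {Δ Θ} : Ctx
    {A F B} : Form
    {intro} : Ded Δ A
    {w} : Γ ≼ Δ
    {arb} : Ded (F ∷ Δ) A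
    {elim} : Ded Θ B
    {v} : (F ∷ Δ) ≼ Θ
    introAt : Desc Π intro w
    isIntro : IntroMaj intro arb
    elimAt  : Desc arb elim v
    isMajor : MajorOf elim (hyp (lift v here))

-- Seg d n : there is a sequence C₁,…,Cₙ of occurrences of the same
-- formula ending with the conclusion of d, each Cᵢ (i<n) an arbitrary
-- premise of a rule with conclusion Cᵢ₊₁
data Seg : ∀ {Γ C} → Ded Γ C → ℕ → Set where
  one  : ∀ {Γ C} {d : Ded Γ C} → Seg d 1
  more : ∀ {Γ Δ C n} {e : Ded Γ C} {d : Ded Δ C} {w : Γ ≼ Δ}
       → ArbOf e d w → Seg d n → Seg e (suc n)

-- a segment (n > 1) whose last formula is the major premise of an
-- elimination rule (hence is not an arbitrary premise)
record MaximalSegment {Γ C} (Π : Ded Γ C) : Set where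
  field
    {Δ} : Ctx
    {A B} : Form
    {elim} : Ded Δ A
    {w} : Γ ≼ Δ
    {maj} : Ded Δ B
    {n} : ℕ
    elimAt  : Desc Π elim w
    isMajor : MajorOf elim maj
    segment : Seg maj n
    long    : 1 < n

Normal : ∀ {Γ C} → Ded Γ C → Set
Normal Π = ¬ MaximalFormula Π × ¬ MaximalSegment Π

{-# OPTIONS --safe #-}
module Submission where

open import Defs
open import Data.Nat using (s≤s; z≤n)
open import Data.Product using (Σ-syntax; ∃-syntax; _,_)
open import Data.Sum using (_⊎_; inj₁; inj₂)
open import Data.Empty using (⊥-elim)
open import Relation.Nullary using (¬_)

-- In system I every rule except ⊥E has an arbitrary premise, so a major
-- premise that is not an assumption ends a segment of length at least 2,
-- i.e. a maximal segment.  The remaining case, ⊥E, concludes an atom,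
-- which is never the major premise of an elimination.

HasArbitraryPremise : ∀ {Γ A} → Ded Γ A → Set
HasArbitraryPremise {Γ} {A} m = ∃[ Δ ] Σ[ d ∈ Ded Δ A ] Σ[ w ∈ Γ ≼ Δ ] ArbOf m d w

majorOf-¬atomic : ∀ {Γ C A} {e : Ded Γ C} {m : Ded Γ A} → MajorOf e m → ¬ Atomic A
majorOf-¬atomic ∧E ()
majorOf-¬atomic ⊃E ()
majorOf-¬atomic ∨E ()
majorOf-¬atomic ⊥E ()

isHyp⊎hasArbitraryPremise : ∀ {Γ A} → ¬ Atomic A → (m : Ded Γ A) →
                            IsHyp m ⊎ HasArbitraryPremise m
isHyp⊎hasArbitraryPremise _   (hyp x)      = inj₁ (hyp x)
isHyp⊎hasArbitraryPremise _   (∧I _ _ d)   = inj₂ (_ , d , _ , ∧I)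
isHyp⊎hasArbitraryPremise _   (⊃I _ d)     = inj₂ (_ , d , _ , ⊃I)
isHyp⊎hasArbitraryPremise _   (∨I₁ _ d)    = inj₂ (_ , d , _ , ∨I₁)
isHyp⊎hasArbitraryPremise _   (∨I₂ _ d)    = inj₂ (_ , d , _ , ∨I₂)
isHyp⊎hasArbitraryPremise _   (∧E _ d)     = inj₂ (_ , d , _ , ∧E)
isHyp⊎hasArbitraryPremise _   (⊃E _ _ d)   = inj₂ (_ , d , _ , ⊃E)
isHyp⊎hasArbitraryPremise _   (∨E _ d₁ _)  = inj₂ (_ , d₁ , _ , ∨E₁)
isHyp⊎hasArbitraryPremise ¬at (⊥E _ at)    = ⊥-elim (¬at at)

maximalSegment-from-arbitraryPremise :
  ∀ {Γ C Δ E A} {Π : Ded Γ C} {e : Ded Δ E} {w : Γ ≼ Δ} {m : Ded Δ A} →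
  Desc Π e w → MajorOf e m → HasArbitraryPremise m → MaximalSegment Π
maximalSegment-from-arbitraryPremise elimAt isMajor (_ , _ , _ , arb) = record
  { elimAt  = elimAt
  ; isMajor = isMajor
  ; segment = more arb one
  ; long    = s≤s (s≤s z≤n)
  }

-- Neither the no-vacuous-discharge convention nor the absence of maximal
-- formulas is needed.
theorem2 : ∀ {Γ C} (Π : Ded Γ C) → NoVacuous Π → Normal Π →
    ∀ {Δ E A} {e : Ded Δ E} {w : Γ ≼ Δ} {m : Ded Δ A} →
    Desc Π e w → MajorOf e m → IsHyp m
theorem2 Π _ (_ , noMaximalSegment) {m = m} elimAt isMajor
  with isHyp⊎hasArbitraryPremise (majorOf-¬atomic isMajor) m
... | inj₁ isHyp = isHyp
... | inj₂ arb   =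
  ⊥-elim (noMaximalSegment (maximalSegment-from-arbitraryPremise elimAt isMajor arb))
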